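{- For $j\ge0$ let $E_{j+1}$ be the digraph with vertex set $\{v_1,\dots,v_{j+1}\}$ and no arcs, and $T_j(X)=T_{E_{j+1},v_1}(X)$. Then $Y=T_j(X)$ satisfies the differential equation $$X\frac{d^2Y}{dX^2}+(2+X)\frac{dY}{dX}-jY=0.$$
   Context: For a finite simple digraph $\mathfrak G=(V,A)$ with $|V|=n$, a disposition is a bijection $f:V\to\{1,\dots,n\}$ with $f(v_1)>f(v_2)$ whenever $(v_1,v_2)\in A$, and $\sigma(\mathfrak G)$ is the number of dispositions. For $v\in V$ and $i\ge0$, $\mathfrak G_i$ is obtained from $\mathfrak G$ by adding new vertices $z_1,\dots,z_i$ and arcs $(z_0,z_1),\dots,(z_{i-1},z_i)$ with $z_0=v$. The companion polynomial $T_{\mathfrak G,v}(X)$ is the (polynomial) power series satisfying $\sum_{i\ge0}\sigma(\mathfrak G_i)X^i/i!=T_{\mathfrak G,v}(X)\exp(X)$. -}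

module Defs where

open import Data.Nat as ℕ using (ℕ; zero; suc; _!; _∸_)
open import Data.Nat.Properties using (_!≢0)
open import Data.Fin as Fin using (Fin; toℕ; splitAt)
open import Data.Bool using (Bool; true; false; _∧_; not; if_then_else_)
open import Data.Sum using (inj₁; inj₂)
open import Data.List using (List; []; _∷_; [_]; map; concatMap; filterᵇ; length; foldr; allFin; upTo)
open import Data.Vec.Functional as VF using ()
open import Relation.Nullary.Decidable using (⌊_⌋)
open import Data.Integer using (+_)
open import Data.Rational using (ℚ; _/_; 0ℚ; _+_; _*_; -_; _-_)

-- Finite simple digraphs on vertex set Fin size; arc u w = true iff (u,w) ∈ A.
-- (A Bool-valued relation rules out multiple arcs.)

record Digraph : Set where
  constructor digraph
  field
    size : ℕ
    arc  : Fin size → Fin size → Bool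
open Digraph public

_==ᶠ_ : ∀ {n} → Fin n → Fin n → Bool
u ==ᶠ w = ⌊ u Fin.≟ w ⌋

_<ᶠ_ : ∀ {n} → Fin n → Fin n → Bool
u <ᶠ w = ⌊ toℕ u ℕ.<? toℕ w ⌋

_⇒ᵇ_ : Bool → Bool → Bool
a ⇒ᵇ b = not a Data.Bool.∨ b

allᵇ : {A : Set} → (A → Bool) → List A → Bool
allᵇ p = foldr (λ x acc → p x ∧ acc) true

allFuns : (n m : ℕ) → List (Fin n → Fin m)
allFuns zero    m = [ (λ ()) ]
allFuns (suc n) m = concatMap (λ f → map (λ x → x VF.∷ f) (allFin m)) (allFuns n m)

-- f : V → {1..n} is encoded as f : Fin n → Fin n (value k stands for k+1).
-- A disposition is a bijection (= injection, V finite of size n) with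
-- f v₁ > f v₂ whenever (v₁ , v₂) ∈ A.
isDisposition : (G : Digraph) → (Fin (size G) → Fin (size G)) → Bool
isDisposition G f =
  allᵇ (λ u → allᵇ (λ w →
        (not (u ==ᶠ w) ⇒ᵇ not (f u ==ᶠ f w))
      ∧ (arc G u w ⇒ᵇ (f w <ᶠ f u))) (allFin (size G))) (allFin (size G))

σ : Digraph → ℕ
σ G = length (filterᵇ (isDisposition G) (allFuns (size G) (size G)))

-- G_i: add z₁..z_i (vertices raise n (k-1)) and arcs (z₀,z₁),…,(z_{i-1},z_i), z₀ = v.
extend : (G : Digraph) → Fin (size G) → ℕ → Digraph
extend G v i = digraph (size G ℕ.+ i) a
  where
  a : Fin (size G ℕ.+ i) → Fin (size G ℕ.+ i) → Bool
  a x y with splitAt (size G) x | splitAt (size G) y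
  ... | inj₁ p | inj₁ q = arc G p q
  ... | inj₁ p | inj₂ l = (p ==ᶠ v) ∧ ⌊ toℕ l ℕ.≟ 0 ⌋
  ... | inj₂ k | inj₂ l = ⌊ toℕ l ℕ.≟ suc (toℕ k) ⌋
  ... | inj₂ k | inj₁ q = false

E : ℕ → Digraph
E m = digraph m (λ _ _ → false)

FPS : Set
FPS = ℕ → ℚ

Σ≤ : ℕ → (ℕ → ℚ) → ℚ
Σ≤ n f = foldr (λ k acc → f k + acc) 0ℚ (upTo (suc n))

_⊛_ : FPS → FPS → FPS
(A ⊛ B) n = Σ≤ n (λ k → A k * B (n ∸ k))

_⊕_ : FPS → FPS → FPS
(A ⊕ B) n = A n + B n

_⊖_ : FPS → FPS → FPS
(A ⊖ B) n = A n - B n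

_·_ : ℕ → FPS → FPS
(c · A) n = (+ c / 1) * A n

X* : FPS → FPS
X* A zero    = 0ℚ
X* A (suc n) = A n

D : FPS → FPS
D A n = (+ suc n / 1) * A (suc n)

expS : FPS
expS n = (+ 1 / (n !)) {{n !≢0}}

egfσ : (G : Digraph) → Fin (size G) → FPS
egfσ G v i = (+ σ (extend G v i) / (i !)) {{i !≢0}}

-- T is the companion power series T_{G,v}: Σ σ(G_i) X^i/i! = T(X) exp(X)
IsCompanion : (G : Digraph) → Fin (size G) → FPS → Set
IsCompanion G v T = ∀ n → (T ⊛ expS) n ≡ egfσ G v n
  where open import Relation.Binary.PropositionalEquality using (_≡_)

-- A disposition of G_i is an injection f with f(v₁) > f(z₁) > ⋯ > f(zᵢ) and no condition on
-- v₂, …, v_{j+1}. Assigning values vertex by vertex (v₁, then v₂, …, v_{j+1}, then the chain),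
-- the count depends only on how many unused values lie below and above f(v₁); this yields
-- σ(G_i) · (i+1)! = (j+1+i)!. By Vandermonde's identity the series
-- Σₖ (j+1)! C(j,k) Xᵏ/(k+1)! times exp(X) has coefficients σ(G_i)/i!, and since exp(X) has
-- constant term 1 it is T_j. The differential equation, read coefficientwise, is the binomial
-- identity (k+1) C(j,k+1) + k C(j,k) = j C(j,k).
module Submission where

open import Defs
open import Data.Nat using (ℕ; suc)
open import Data.Fin using (zero)
open import Data.Rational using (0ℚ)
open import Relation.Binary.PropositionalEquality using (_≡_)

module FiniteSums where

  open import Algebra.Bundles using (Monoid)
  open import Data.Fin using (toℕ)
  open import Data.Fin.Properties using (toℕ-inject₁; toℕ-fromℕ)
  open import Function using (_∘_)
  open import Relation.Binary.PropositionalEquality using (cong)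

  module _ {c ℓ} (M : Monoid c ℓ) where
    open Monoid M
    open import Algebra.Properties.Monoid.Sum M using (sum-syntax; sum-init-last; sum-cong-≗)

    ∑-toℕ-last : ∀ n (f : ℕ → Carrier) → ∑[ k < suc n ] f (toℕ k) ≈ ∑[ k < n ] f (toℕ k) ∙ f n
    ∑-toℕ-last n f = trans (sum-init-last {n} (f ∘ toℕ))
      (∙-cong (reflexive (sum-cong-≗ {n} (cong f ∘ toℕ-inject₁))) (reflexive (cong f (toℕ-fromℕ n))))

module Binomial where

  open FiniteSums
  open import Data.Nat
  open import Data.Nat.Properties
  open import Data.Nat.Combinatorics
  open import Data.Nat.DivMod using (m/n*n≡m)
  open import Data.Nat.Solver using (module +-*-Solver)
  open import Data.Fin using (Fin; toℕ)
  open import Data.Fin.Properties using (toℕ≤pred[n])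
  open import Algebra.Properties.Semiring.Sum +-*-semiring
    using (sum-syntax; ∑-distrib-+; sum-cong-≗; sum-replicate-zero)
  open import Relation.Binary.PropositionalEquality
  open +-*-Solver

  nCk*k!*[n∸k]!≡n! : ∀ {n k} → k ≤ n → (n C k) * (k ! * (n ∸ k) !) ≡ n !
  nCk*k!*[n∸k]!≡n! {n} {k} k≤n = begin
    (n C k) * (k ! * (n ∸ k) !)                 ≡⟨ cong (_* (k ! * (n ∸ k) !)) (nCk≡n!/k![n-k]! k≤n) ⟩
    n ! / (k ! * (n ∸ k) !) * (k ! * (n ∸ k) !) ≡⟨ m/n*n≡m (k![n∸k]!∣n! k≤n) ⟩
    n !                                         ∎
    where
    open ≡-Reasoning
    instance _ = k !* (n ∸ k) !≢0

  [m+n]Cn*[m!*n!]≡[m+n]! : ∀ m n → ((m + n) C n) * (m ! * n !) ≡ (m + n) !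
  [m+n]Cn*[m!*n!]≡[m+n]! m n = begin
    ((m + n) C n) * (m ! * n !)           ≡⟨ cong (((m + n) C n) *_) (*-comm (m !) (n !)) ⟩
    ((m + n) C n) * (n ! * m !)           ≡⟨ cong (λ k → ((m + n) C n) * (n ! * k !)) (m+n∸n≡m m n) ⟨
    ((m + n) C n) * (n ! * (m + n ∸ n) !) ≡⟨ nCk*k!*[n∸k]!≡n! (m≤n+m n m) ⟩
    (m + n) !                             ∎
    where open ≡-Reasoning

  hockey-stick : ∀ L r → ∑[ t < L ] (toℕ t C r) ≡ L C suc r
  hockey-stick zero    r = refl
  hockey-stick (suc L) r = begin
    ∑[ t < suc L ] (toℕ t C r)     ≡⟨ ∑-toℕ-last +-0-monoid L (_C r) ⟩
    ∑[ t < L ] (toℕ t C r) + L C r ≡⟨ cong (_+ L C r) (hockey-stick L r) ⟩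
    L C suc r + L C r              ≡⟨ +-comm (L C suc r) (L C r) ⟩
    L C r + L C suc r              ≡⟨ nCk+nC[k+1]≡[n+1]C[k+1] L r ⟩
    suc L C suc r                  ∎
    where open ≡-Reasoning

  vandermonde : ∀ a b n → ∑[ k < suc n ] ((a C toℕ k) * (b C (n ∸ toℕ k))) ≡ (a + b) C n
  vandermonde zero    b n       = begin
    1 * (b C n) + ∑[ k < n ] 0 ≡⟨ cong₂ _+_ (*-identityˡ (b C n)) (sum-replicate-zero n) ⟩
    b C n + 0                  ≡⟨ +-identityʳ (b C n) ⟩
    b C n                      ∎
    where open ≡-Reasoning
  vandermonde (suc a) b zero    = refl
  vandermonde (suc a) b (suc n) = begin
    1 * (b C suc n) + ∑[ k < suc n ] ((suc a C suc (toℕ k)) * (b C (n ∸ toℕ k)))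
      ≡⟨ cong (1 * (b C suc n) +_) (trans (sum-cong-≗ {suc n} split) (∑-distrib-+ lower upper)) ⟩
    1 * (b C suc n) + (∑[ k < suc n ] lower k + ∑[ k < suc n ] upper k)
      ≡⟨ solve 3 (λ c l u → c :+ (l :+ u) := l :+ (c :+ u)) refl
               (1 * (b C suc n)) (∑[ k < suc n ] lower k) (∑[ k < suc n ] upper k) ⟩
    ∑[ k < suc n ] lower k + (1 * (b C suc n) + ∑[ k < suc n ] upper k)
      ≡⟨ cong₂ _+_ (vandermonde a b n) (vandermonde a b (suc n)) ⟩
    (a + b) C n + (a + b) C suc n
      ≡⟨ nCk+nC[k+1]≡[n+1]C[k+1] (a + b) n ⟩
    suc (a + b) C suc n ∎
    where
    open ≡-Reasoning
    lower upper : Fin (suc n) → ℕ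
    lower k = (a C toℕ k) * (b C (n ∸ toℕ k))
    upper k = (a C suc (toℕ k)) * (b C (n ∸ toℕ k))
    split : ∀ k → (suc a C suc (toℕ k)) * (b C (n ∸ toℕ k)) ≡ lower k + upper k
    split k = trans (cong (_* (b C (n ∸ toℕ k))) (sym (nCk+nC[k+1]≡[n+1]C[k+1] a (toℕ k))))
                    (*-distribʳ-+ (b C (n ∸ toℕ k)) (a C toℕ k) _)

  ∑jCk*[1+n]C[1+k]≡[1+j+n]Cn : ∀ j n → ∑[ k < suc n ] ((j C toℕ k) * (suc n C suc (toℕ k))) ≡ (suc j + n) C n
  ∑jCk*[1+n]C[1+k]≡[1+j+n]Cn j n = begin
    ∑[ k < suc n ] ((j C toℕ k) * (suc n C suc (toℕ k)))
      ≡⟨ sum-cong-≗ {suc n} (λ k → cong ((j C toℕ k) *_) (nCk≡nC[n∸k] (s≤s (toℕ≤pred[n] k)))) ⟩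
    ∑[ k < suc n ] ((j C toℕ k) * (suc n C (n ∸ toℕ k))) ≡⟨ vandermonde j (suc n) n ⟩
    (j + suc n) C n                                      ≡⟨ cong (_C n) (+-suc j n) ⟩
    (suc j + n) C n                                      ∎
    where open ≡-Reasoning

  [1+k]*nC[1+k]+k*nCk≡n*nCk : ∀ n k → suc k * (n C suc k) + k * (n C k) ≡ n * (n C k)
  [1+k]*nC[1+k]+k*nCk≡n*nCk zero    zero    = refl
  [1+k]*nC[1+k]+k*nCk≡n*nCk zero    (suc k) = cong₂ _+_ (*-zeroʳ (suc (suc k))) (*-zeroʳ (suc k))
  [1+k]*nC[1+k]+k*nCk≡n*nCk (suc n) zero    =
    trans (+-identityʳ _) (trans (*-identityˡ _) (trans (nC1≡n (suc n)) (sym (*-identityʳ (suc n)))))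
  [1+k]*nC[1+k]+k*nCk≡n*nCk (suc n) (suc k) = begin
    suc (suc k) * (suc n C suc (suc k)) + suc k * (suc n C suc k)
      ≡⟨ cong₂ (λ x y → suc (suc k) * x + suc k * y) (nCk+nC[k+1]≡[n+1]C[k+1] n (suc k)) (nCk+nC[k+1]≡[n+1]C[k+1] n k) ⟨
    suc (suc k) * (b₁ + b₂) + suc k * (b₀ + b₁)
      ≡⟨ solve 4 (λ k b₀ b₁ b₂ → (con 2 :+ k) :* (b₁ :+ b₂) :+ (con 1 :+ k) :* (b₀ :+ b₁)
                    := ((con 2 :+ k) :* b₂ :+ (con 1 :+ k) :* b₁) :+ b₁ :+ ((con 1 :+ k) :* b₁ :+ k :* b₀) :+ b₀)
               refl k b₀ b₁ b₂ ⟩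
    (suc (suc k) * b₂ + suc k * b₁) + b₁ + (suc k * b₁ + k * b₀) + b₀
      ≡⟨ cong₂ (λ x y → x + b₁ + y + b₀) ([1+k]*nC[1+k]+k*nCk≡n*nCk n (suc k)) ([1+k]*nC[1+k]+k*nCk≡n*nCk n k) ⟩
    n * b₁ + b₁ + n * b₀ + b₀
      ≡⟨ solve 3 (λ n b₀ b₁ → n :* b₁ :+ b₁ :+ n :* b₀ :+ b₀ := (con 1 :+ n) :* (b₀ :+ b₁)) refl n b₀ b₁ ⟩
    suc n * (b₀ + b₁)
      ≡⟨ cong (suc n *_) (nCk+nC[k+1]≡[n+1]C[k+1] n k) ⟩
    suc n * (suc n C suc k) ∎
    where
    open ≡-Reasoning
    b₀ = n C k
    b₁ = n C suc k
    b₂ = n C suc (suc k)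

module FunctionCount where

  open import Data.Nat
  open import Data.Nat.Properties using (+-identityʳ; +-*-semiring)
  open import Data.Bool using (Bool; true; false; _∧_; T)
  open import Data.Fin using (Fin) renaming (zero to fzero; suc to fsuc)
  open import Data.List using (List; []; _∷_; _++_; map; concatMap; filterᵇ; length; allFin; tabulate)
  open import Data.List.Properties using (length-++; filter-++; map-tabulate; filter-none; filter-≐)
  open import Data.List.Relation.Unary.All using (universal)
  open import Data.Product using (_,_)
  import Data.Vec.Functional as Vector
  open import Algebra.Properties.Semiring.Sum +-*-semiring
    using (sum-syntax; ∑-distrib-+; sum-cong-≗; sum-replicate-zero)
  open import Function using (_∘_; id; _⇔_; Equivalence)
  open import Relation.Nullary.Decidable using (T?)
  open import Relation.Binary.PropositionalEquality

  𝟙[_] : Bool → ℕ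
  𝟙[ true  ] = 1
  𝟙[ false ] = 0

  length-filterᵇ-∷ : ∀ {A : Set} (p : A → Bool) x xs → length (filterᵇ p (x ∷ xs)) ≡ 𝟙[ p x ] + length (filterᵇ p xs)
  length-filterᵇ-∷ p x xs with p x
  ... | true  = refl
  ... | false = refl

  length-filterᵇ-tabulate : ∀ {A : Set} (p : A → Bool) {m} (h : Fin m → A) →
                            length (filterᵇ p (tabulate h)) ≡ ∑[ x < m ] 𝟙[ p (h x) ]
  length-filterᵇ-tabulate p {zero}  h = refl
  length-filterᵇ-tabulate p {suc m} h = trans (length-filterᵇ-∷ p (h fzero) _)
    (cong (𝟙[ p (h fzero) ] +_) (length-filterᵇ-tabulate p (h ∘ fsuc)))

  countFuns : ∀ n m → ((Fin n → Fin m) → Bool) → ℕ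
  countFuns n m P = length (filterᵇ P (allFuns n m))

  countFuns-cong : ∀ {n m} {P Q : (Fin n → Fin m) → Bool} → (∀ f → T (P f) ⇔ T (Q f)) → countFuns n m P ≡ countFuns n m Q
  countFuns-cong {n} {m} {P} {Q} P⇔Q =
    cong length (filter-≐ (T? ∘ P) (T? ∘ Q) (Equivalence.to (P⇔Q _) , Equivalence.from (P⇔Q _)) (allFuns n m))

  countFuns-suc : ∀ n m (P : (Fin (suc n) → Fin m) → Bool) →
                  countFuns (suc n) m P ≡ ∑[ x < m ] countFuns n m (λ f → P (x Vector.∷ f))
  countFuns-suc n m P = go (allFuns n m)
    where
    extensions : (Fin n → Fin m) → List (Fin (suc n) → Fin m)
    extensions f = map (Vector._∷ f) (allFin m)
    go : ∀ fs → length (filterᵇ P (concatMap extensions fs)) ≡ ∑[ x < m ] length (filterᵇ (λ f → P (x Vector.∷ f)) fs)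
    go []       = sym (sum-replicate-zero m)
    go (f ∷ fs) = begin
      length (filterᵇ P (extensions f ++ concatMap extensions fs))
        ≡⟨ cong length (filter-++ (T? ∘ P) (extensions f) _) ⟩
      length (filterᵇ P (extensions f) ++ filterᵇ P (concatMap extensions fs))
        ≡⟨ length-++ (filterᵇ P (extensions f)) ⟩
      length (filterᵇ P (extensions f)) + length (filterᵇ P (concatMap extensions fs))
        ≡⟨ cong₂ _+_ (trans (cong (length ∘ filterᵇ P) (map-tabulate id (Vector._∷ f)))
                            (length-filterᵇ-tabulate P (Vector._∷ f)))
                     (go fs) ⟩
      ∑[ x < m ] 𝟙[ P (x Vector.∷ f) ] + ∑[ x < m ] length (filterᵇ (λ g → P (x Vector.∷ g)) fs)
        ≡⟨ ∑-distrib-+ (λ x → 𝟙[ P (x Vector.∷ f) ]) _ ⟨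
      ∑[ x < m ] (𝟙[ P (x Vector.∷ f) ] + length (filterᵇ (λ g → P (x Vector.∷ g)) fs))
        ≡⟨ sum-cong-≗ (λ x → length-filterᵇ-∷ (λ g → P (x Vector.∷ g)) f fs) ⟨
      ∑[ x < m ] length (filterᵇ (λ g → P (x Vector.∷ g)) (f ∷ fs)) ∎
      where open ≡-Reasoning

  countFuns-∧ : ∀ n m c (P : (Fin n → Fin m) → Bool) → countFuns n m (λ f → c ∧ P f) ≡ 𝟙[ c ] * countFuns n m P
  countFuns-∧ n m true  P = sym (+-identityʳ _)
  countFuns-∧ n m false P = cong length (filter-none (T? ∘ (λ _ → false)) (universal (λ _ ()) (allFuns n m)))

module DescendingAssignment where

  open import Data.Nat as ℕ using (ℕ; zero; suc; _+_; _≤_; _<ᵇ_; z≤n; s≤s)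
  import Data.Nat.Properties as ℕ
  open import Data.Nat.Properties using (<ᵇ⇒<; <⇒<ᵇ; <-trans; <-irrefl)
  open import Data.Bool using (Bool; true; false; _∧_; _∨_; not; T)
  open import Data.Bool.Properties using (T-∧)
  open import Data.Empty using (⊥-elim)
  open import Data.Fin as Fin using (Fin; toℕ) renaming (zero to fzero; suc to fsuc)
  open import Data.Fin.Properties using (0≢1+n; suc-injective)
  open import Data.Product using (_×_; _,_; proj₁; proj₂)
  open import Data.Unit using (tt)
  open import Function using (_∘_; _⇔_; mk⇔; Injective; Equivalence)
  open Equivalence using (to; from)
  open import Relation.Nullary.Decidable using (toWitnessFalse; fromWitnessFalse)
  open import Relation.Binary.PropositionalEquality

  insert : ∀ {M} → Fin M → (Fin M → Bool) → Fin M → Bool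
  insert x U y = (y ==ᶠ x) ∨ U y

  -- g is read one vertex at a time: U marks the values already used, and b is the bound
  -- below which the next chain value must lie.
  descendingᵇ : ∀ r {M} → (Fin M → Bool) → ℕ → (Fin r → Fin M) → Bool
  descendingᵇ zero    U b g = true
  descendingᵇ (suc r) U b g = ((toℕ (g fzero) <ᵇ b) ∧ not (U (g fzero))) ∧ descendingᵇ r U (toℕ (g fzero)) (g ∘ fsuc)

  freeThenDescendingᵇ : ∀ j r {M} → (Fin M → Bool) → ℕ → (Fin (j + r) → Fin M) → Bool
  freeThenDescendingᵇ zero    r U b g = descendingᵇ r U b g
  freeThenDescendingᵇ (suc j) r U b g = not (U (g fzero)) ∧ freeThenDescendingᵇ j r (insert (g fzero) U) b (g ∘ fsuc)

  T-not-∨ : ∀ x y → T (not (x ∨ y)) ⇔ (T (not x) × T (not y))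
  T-not-∨ true  y     = mk⇔ (λ ()) proj₁
  T-not-∨ false true  = mk⇔ (λ ()) proj₂
  T-not-∨ false false = mk⇔ (λ _ → tt , tt) (λ _ → tt)

  record FreeThenDescending (j r : ℕ) {M} (U : Fin M → Bool) (b : ℕ) (g : Fin (j + r) → Fin M) : Set where
    field
      unused     : ∀ k → T (not (U (g k)))
      injective  : Injective _≡_ _≡_ g
      belowBound : ∀ {k} → toℕ k ≡ j → toℕ (g k) ℕ.< b
      descending : ∀ {k k'} → j ≤ toℕ k → toℕ k' ≡ suc (toℕ k) → g k' Fin.< g k

  descendingᵇ-bounded : ∀ r {M} (U : Fin M → Bool) b g → T (descendingᵇ r U b g) → ∀ k → toℕ (g k) ℕ.< b
  descendingᵇ-bounded (suc r) U b g h fzero    = <ᵇ⇒< _ _ (proj₁ (to T-∧ (proj₁ (to T-∧ h))))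
  descendingᵇ-bounded (suc r) U b g h (fsuc k) =
    <-trans (descendingᵇ-bounded r U _ (g ∘ fsuc) (proj₂ (to T-∧ h)) k) (descendingᵇ-bounded (suc r) U b g h fzero)

  descendingᵇ-sound : ∀ r {M} (U : Fin M → Bool) b g → T (descendingᵇ r U b g) → FreeThenDescending 0 r U b g
  descendingᵇ-sound zero    U b g h = record
    { unused = λ () ; injective = λ { {()} } ; belowBound = λ { {()} } ; descending = λ { {()} } }
  descendingᵇ-sound (suc r) U b g h = record
    { unused = λ { fzero → unused₀ ; (fsuc k) → FreeThenDescending.unused rest k }
    ; injective = injective
    ; belowBound = λ { {fzero} _ → g₀<b }
    ; descending = λ { {fzero} {fsuc k'} _ k'≡1 → FreeThenDescending.belowBound rest (ℕ.suc-injective k'≡1)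
                     ; {fsuc k} {fsuc k'} _ k'≡ → FreeThenDescending.descending rest z≤n (ℕ.suc-injective k'≡) }
    }
    where
    head&rest = to T-∧ h
    g₀<b = <ᵇ⇒< _ _ (proj₁ (to T-∧ (proj₁ head&rest)))
    unused₀ = proj₂ (to T-∧ (proj₁ head&rest))
    rest = descendingᵇ-sound r U _ (g ∘ fsuc) (proj₂ head&rest)
    below₀ = descendingᵇ-bounded r U _ (g ∘ fsuc) (proj₂ head&rest)
    injective : Injective _≡_ _≡_ g
    injective {fzero}  {fzero}   _  = refl
    injective {fzero}  {fsuc k}  eq = ⊥-elim (<-irrefl (cong toℕ (sym eq)) (below₀ k))
    injective {fsuc k} {fzero}   eq = ⊥-elim (<-irrefl (cong toℕ eq) (below₀ k))
    injective {fsuc k} {fsuc k'} eq = cong fsuc (FreeThenDescending.injective rest eq)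

  descendingᵇ-complete : ∀ r {M} (U : Fin M → Bool) b g → FreeThenDescending 0 r U b g → T (descendingᵇ r U b g)
  descendingᵇ-complete zero    U b g s = tt
  descendingᵇ-complete (suc r) U b g s = from T-∧
    ( from T-∧ (<⇒<ᵇ (belowBound refl) , unused fzero)
    , descendingᵇ-complete r U _ (g ∘ fsuc) (record
        { unused     = unused ∘ fsuc
        ; injective  = suc-injective ∘ injective
        ; belowBound = λ k≡0 → descending z≤n (cong suc k≡0)
        ; descending = λ _ k'≡1+k → descending z≤n (cong suc k'≡1+k)
        }))
    where open FreeThenDescending s

  freeThenDescendingᵇ-sound : ∀ j r {M} (U : Fin M → Bool) b g → T (freeThenDescendingᵇ j r U b g) → FreeThenDescending j r U b g
  freeThenDescendingᵇ-sound zero    r U b g h = descendingᵇ-sound r U b g h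
  freeThenDescendingᵇ-sound (suc j) r U b g h = record
    { unused     = λ { fzero → unused₀ ; (fsuc k) → proj₂ (unusedRest k) }
    ; injective  = injective
    ; belowBound = λ { {fsuc k} k≡1+j → FreeThenDescending.belowBound rest (ℕ.suc-injective k≡1+j) }
    ; descending = λ { {fsuc k} {fsuc k'} (s≤s j≤k) k'≡1+k → FreeThenDescending.descending rest j≤k (ℕ.suc-injective k'≡1+k) }
    }
    where
    unused₀ = proj₁ (to T-∧ h)
    rest = freeThenDescendingᵇ-sound j r (insert (g fzero) U) b (g ∘ fsuc) (proj₂ (to T-∧ h))
    unusedRest : ∀ k → T (not (g (fsuc k) ==ᶠ g fzero)) × T (not (U (g (fsuc k))))
    unusedRest k = to (T-not-∨ _ _) (FreeThenDescending.unused rest k)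
    injective : Injective _≡_ _≡_ g
    injective {fzero}  {fzero}   _  = refl
    injective {fzero}  {fsuc k}  eq = ⊥-elim (toWitnessFalse (proj₁ (unusedRest k)) (sym eq))
    injective {fsuc k} {fzero}   eq = ⊥-elim (toWitnessFalse (proj₁ (unusedRest k)) eq)
    injective {fsuc k} {fsuc k'} eq = cong fsuc (FreeThenDescending.injective rest eq)

  freeThenDescendingᵇ-complete : ∀ j r {M} (U : Fin M → Bool) b g → FreeThenDescending j r U b g → T (freeThenDescendingᵇ j r U b g)
  freeThenDescendingᵇ-complete zero    r U b g s = descendingᵇ-complete r U b g s
  freeThenDescendingᵇ-complete (suc j) r U b g s = from T-∧
    ( unused fzero
    , freeThenDescendingᵇ-complete j r (insert (g fzero) U) b (g ∘ fsuc) (record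
        { unused     = λ k → from (T-not-∨ _ _) (fromWitnessFalse (0≢1+n ∘ injective ∘ sym) , unused (fsuc k))
        ; injective  = suc-injective ∘ injective
        ; belowBound = λ k≡j → belowBound (cong suc k≡j)
        ; descending = λ j≤k k'≡1+k → descending (s≤s j≤k) (cong suc k'≡1+k)
        }))
    where open FreeThenDescending s

  T-freeThenDescendingᵇ : ∀ j r {M} (U : Fin M → Bool) b g →
                          T (freeThenDescendingᵇ j r U b g) ⇔ FreeThenDescending j r U b g
  T-freeThenDescendingᵇ j r U b g = mk⇔ (freeThenDescendingᵇ-sound j r U b g) (freeThenDescendingᵇ-complete j r U b g)

module Placements where

  open FiniteSums
  open DescendingAssignment using (insert; descendingᵇ; freeThenDescendingᵇ)
  open Binomial using (hockey-stick)
  open FunctionCount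
  open import Data.Nat
  open import Data.Nat.Properties
  open import Data.Nat.Combinatorics using (_C_; nCn≡1)
  open import Data.Bool using (Bool; true; false; _∧_; _∨_; not)
  open import Data.Fin as Fin using (Fin; toℕ) renaming (zero to fzero; suc to fsuc)
  open import Data.Fin.Properties using (toℕ<n)
  open import Algebra.Properties.Semiring.Sum +-*-semiring
    using (sum-syntax; ∑-distrib-+; sum-cong-≗; sum-replicate-zero; *-distribʳ-sum; *-distribˡ-sum)
  open import Function using (_∘_)
  open import Relation.Nullary.Decidable using (⌊⌋-map′)
  open import Relation.Binary.PropositionalEquality

  #unused : ∀ {M} → (Fin M → Bool) → (Fin M → Bool) → ℕ
  #unused {M} p U = ∑[ y < M ] 𝟙[ p y ∧ not (U y) ]

  #below #above : ∀ {M} → (Fin M → Bool) → ℕ → ℕ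
  #below U b = #unused (λ y → toℕ y <ᵇ b) U
  #above U b = #unused (λ y → not (toℕ y <ᵇ b)) U

  ∑1≡n : ∀ n → ∑[ _ < n ] 1 ≡ n
  ∑1≡n zero    = refl
  ∑1≡n (suc n) = cong suc (∑1≡n n)

  ==ᶠ-suc : ∀ {n} (x y : Fin n) → (fsuc x ==ᶠ fsuc y) ≡ (x ==ᶠ y)
  ==ᶠ-suc x y = ⌊⌋-map′ _ _ (x Fin.≟ y)

  insert-suc : ∀ {M} (x : Fin M) U y → insert (fsuc x) U (fsuc y) ≡ insert x (U ∘ fsuc) y
  insert-suc x U y = cong (_∨ U (fsuc y)) (==ᶠ-suc y x)

  #unused-insert : ∀ {M} (p U : Fin M → Bool) {x} → U x ≡ false → #unused p (insert x U) + 𝟙[ p x ] ≡ #unused p U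
  #unused-insert {suc M} p U {fzero} Ux≡false rewrite Ux≡false with p fzero
  ... | true  = +-comm (#unused (p ∘ fsuc) (U ∘ fsuc)) 1
  ... | false = +-identityʳ _
  #unused-insert {suc M} p U {fsuc x} Ux≡false = begin
    u₀ + #unused (p ∘ fsuc) (insert (fsuc x) U ∘ fsuc) + 𝟙[ p (fsuc x) ]
      ≡⟨ cong (λ n → u₀ + n + 𝟙[ p (fsuc x) ])
              (sum-cong-≗ (λ y → cong (λ c → 𝟙[ p (fsuc y) ∧ not c ]) (insert-suc x U y))) ⟩
    u₀ + #unused (p ∘ fsuc) (insert x (U ∘ fsuc)) + 𝟙[ p (fsuc x) ]
      ≡⟨ +-assoc u₀ _ _ ⟩
    u₀ + (#unused (p ∘ fsuc) (insert x (U ∘ fsuc)) + 𝟙[ p (fsuc x) ])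
      ≡⟨ cong (u₀ +_) (#unused-insert (p ∘ fsuc) (U ∘ fsuc) {x} Ux≡false) ⟩
    u₀ + #unused (p ∘ fsuc) (U ∘ fsuc) ∎
    where
    open ≡-Reasoning
    u₀ = 𝟙[ p fzero ∧ not (U fzero) ]

  #unused-insert-∸ : ∀ {M} (p U : Fin M → Bool) {x} → U x ≡ false → #unused p (insert x U) ≡ #unused p U ∸ 𝟙[ p x ]
  #unused-insert-∸ p U {x} Ux≡false =
    trans (sym (m+n∸n≡m _ 𝟙[ p x ])) (cong (_∸ 𝟙[ p x ]) (#unused-insert p U Ux≡false))

  #below-singleton : ∀ {M} (a : Fin M) → #below (_==ᶠ a) (toℕ a) ≡ toℕ a
  #below-singleton {suc M} fzero    = sum-replicate-zero M
  #below-singleton         (fsuc a) = cong suc (trans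
    (sum-cong-≗ (λ y → cong (λ b → 𝟙[ (toℕ y <ᵇ toℕ a) ∧ not b ]) (==ᶠ-suc y a)))
    (#below-singleton a))

  #above-singleton : ∀ {M} (a : Fin M) → #above (_==ᶠ a) (toℕ a) ≡ M ∸ suc (toℕ a)
  #above-singleton {suc M} fzero    = ∑1≡n M
  #above-singleton         (fsuc a) = trans
    (sum-cong-≗ (λ y → cong (λ b → 𝟙[ not (toℕ y <ᵇ toℕ a) ∧ not b ]) (==ᶠ-suc y a)))
    (#above-singleton a)

  -- Listed in increasing order, the unused values below b have ranks 0, 1, …, #below U b − 1.
  ∑-rank : ∀ {M} (U : Fin M → Bool) b (f : ℕ → ℕ) →
           ∑[ x < M ] (𝟙[ (toℕ x <ᵇ b) ∧ not (U x) ] * f (#below U (toℕ x))) ≡ ∑[ t < #below U b ] f (toℕ t)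
  ∑-rank {zero}  U b       f = refl
  ∑-rank {suc M} U zero    f = trans (sum-replicate-zero (suc M)) (sym (cong (λ L → ∑[ t < L ] f (toℕ t)) (sum-replicate-zero (suc M))))
  ∑-rank {suc M} U (suc b) f with U fzero
  ... | true  = ∑-rank (U ∘ fsuc) b f
  ... | false = cong₂ _+_ (trans (*-identityˡ _) (cong f (sum-replicate-zero M))) (∑-rank (U ∘ fsuc) b (f ∘ suc))

  -- The first free vertex takes one of the l unused values below the bound or one of the h above it.
  placements : ℕ → ℕ → ℕ → ℕ → ℕ
  placements zero    r l h = l C r
  placements (suc j) r l h = l * placements j r (l ∸ 1) h + h * placements j r l (h ∸ 1)

  count-descending : ∀ r M (U : Fin M → Bool) b → countFuns r M (descendingᵇ r U b) ≡ #below U b C r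
  count-descending zero    M U b = refl
  count-descending (suc r) M U b = begin
    countFuns (suc r) M (descendingᵇ (suc r) U b)
      ≡⟨ countFuns-suc r M _ ⟩
    ∑[ x < M ] countFuns r M (λ g → below x ∧ descendingᵇ r U (toℕ x) g)
      ≡⟨ sum-cong-≗ (λ x → trans (countFuns-∧ r M (below x) _) (cong (𝟙[ below x ] *_) (count-descending r M U (toℕ x)))) ⟩
    ∑[ x < M ] (𝟙[ below x ] * (#below U (toℕ x) C r))
      ≡⟨ ∑-rank U b (_C r) ⟩
    ∑[ t < #below U b ] (toℕ t C r)
      ≡⟨ hockey-stick (#below U b) r ⟩
    #below U b C suc r ∎
    where
    open ≡-Reasoning
    below : Fin M → Bool
    below x = (toℕ x <ᵇ b) ∧ not (U x)

  count-freeThenDescending : ∀ j r M (U : Fin M → Bool) b →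
    countFuns (j + r) M (freeThenDescendingᵇ j r U b) ≡ placements j r (#below U b) (#above U b)
  count-freeThenDescending zero    r M U b = count-descending r M U b
  count-freeThenDescending (suc j) r M U b = begin
    countFuns (suc j + r) M (freeThenDescendingᵇ (suc j) r U b)
      ≡⟨ countFuns-suc (j + r) M _ ⟩
    ∑[ x < M ] countFuns (j + r) M (λ g → not (U x) ∧ freeThenDescendingᵇ j r (insert x U) b g)
      ≡⟨ sum-cong-≗ (λ x → trans (countFuns-∧ (j + r) M (not (U x)) _)
                                   (cong (𝟙[ not (U x) ] *_) (count-freeThenDescending j r M (insert x U) b))) ⟩
    ∑[ x < M ] (𝟙[ not (U x) ] * placements j r (#below (insert x U) b) (#above (insert x U) b))
      ≡⟨ sum-cong-≗ split ⟩
    ∑[ x < M ] (𝟙[ isBelow x ] * placements j r (l ∸ 1) h + 𝟙[ isAbove x ] * placements j r l (h ∸ 1))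
      ≡⟨ ∑-distrib-+ (λ x → 𝟙[ isBelow x ] * placements j r (l ∸ 1) h) (λ x → 𝟙[ isAbove x ] * placements j r l (h ∸ 1)) ⟩
    ∑[ x < M ] (𝟙[ isBelow x ] * placements j r (l ∸ 1) h) + ∑[ x < M ] (𝟙[ isAbove x ] * placements j r l (h ∸ 1))
      ≡⟨ cong₂ _+_ (*-distribʳ-sum (placements j r (l ∸ 1) h) (𝟙[_] ∘ isBelow))
                   (*-distribʳ-sum (placements j r l (h ∸ 1)) (𝟙[_] ∘ isAbove)) ⟨
    l * placements j r (l ∸ 1) h + h * placements j r l (h ∸ 1) ∎
    where
    open ≡-Reasoning
    l = #below U b
    h = #above U b
    isBelow isAbove : Fin M → Bool
    isBelow x = (toℕ x <ᵇ b) ∧ not (U x)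
    isAbove x = not (toℕ x <ᵇ b) ∧ not (U x)
    split : ∀ x → 𝟙[ not (U x) ] * placements j r (#below (insert x U) b) (#above (insert x U) b)
                ≡ 𝟙[ isBelow x ] * placements j r (l ∸ 1) h + 𝟙[ isAbove x ] * placements j r l (h ∸ 1)
    split x with U x in Ux≡false | toℕ x <ᵇ b in x<b
    ... | true  | true  = refl
    ... | true  | false = refl
    ... | false | true  = cong (_+ 0) (trans (cong₂ (placements j r) below-drops above-stays) (sym (+-identityʳ _)))
      where
      below-drops : #below (insert x U) b ≡ l ∸ 1
      below-drops = trans (#unused-insert-∸ _ U Ux≡false) (cong (λ c → l ∸ 𝟙[ c ]) x<b)
      above-stays : #above (insert x U) b ≡ h
      above-stays = trans (#unused-insert-∸ _ U Ux≡false) (cong (λ c → h ∸ 𝟙[ not c ]) x<b)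
    ... | false | false = cong (_+ 0) (cong₂ (placements j r) below-stays above-drops)
      where
      below-stays : #below (insert x U) b ≡ l
      below-stays = trans (#unused-insert-∸ _ U Ux≡false) (cong (λ c → l ∸ 𝟙[ c ]) x<b)
      above-drops : #above (insert x U) b ≡ h ∸ 1
      above-drops = trans (#unused-insert-∸ _ U Ux≡false) (cong (λ c → h ∸ 𝟙[ not c ]) x<b)

  -- The root takes the value a, leaving a values below it and N − 1 − a above it.
  rootedPlacements : ℕ → ℕ → ℕ → ℕ
  rootedPlacements j i N = ∑[ a < N ] placements j i (toℕ a) (N ∸ suc (toℕ a))

  -- After shifting the first sum by one, both sums carry g a, with total weight (a + 1) + (N − a) = N + 1.
  rootedPlacements-suc : ∀ j i N → rootedPlacements (suc j) i (suc N) ≡ suc N * rootedPlacements j i N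
  rootedPlacements-suc j i N = begin
    ∑[ a < suc N ] (fromBelow (toℕ a) + fromAbove (toℕ a))
      ≡⟨ ∑-distrib-+ {suc N} (fromBelow ∘ toℕ) (fromAbove ∘ toℕ) ⟩
    ∑[ a < N ] (suc (toℕ a) * g a) + ∑[ a < suc N ] fromAbove (toℕ a)
      ≡⟨ cong (∑[ a < N ] (suc (toℕ a) * g a) +_) (∑-toℕ-last +-0-monoid N fromAbove) ⟩
    ∑[ a < N ] (suc (toℕ a) * g a) + (∑[ a < N ] fromAbove (toℕ a) + fromAbove N)
      ≡⟨ cong (∑[ a < N ] (suc (toℕ a) * g a) +_) (trans (cong₂ _+_ (sum-cong-≗ {N} fromAbove≡) fromAbove-N) (+-identityʳ _)) ⟩
    ∑[ a < N ] (suc (toℕ a) * g a) + ∑[ a < N ] ((N ∸ toℕ a) * g a)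
      ≡⟨ ∑-distrib-+ {N} (λ a → suc (toℕ a) * g a) (λ a → (N ∸ toℕ a) * g a) ⟨
    ∑[ a < N ] (suc (toℕ a) * g a + (N ∸ toℕ a) * g a)
      ≡⟨ sum-cong-≗ (λ a → trans (sym (*-distribʳ-+ (g a) (suc (toℕ a)) (N ∸ toℕ a)))
                                   (cong (λ m → suc m * g a) (m+[n∸m]≡n (<⇒≤ (toℕ<n a))))) ⟩
    ∑[ a < N ] (suc N * g a)
      ≡⟨ *-distribˡ-sum (suc N) g ⟨
    suc N * rootedPlacements j i N ∎
    where
    open ≡-Reasoning
    g : Fin N → ℕ
    g a = placements j i (toℕ a) (N ∸ suc (toℕ a))
    fromBelow fromAbove : ℕ → ℕ
    fromBelow a = a * placements j i (a ∸ 1) (N ∸ a)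
    fromAbove a = (N ∸ a) * placements j i a (N ∸ a ∸ 1)
    fromAbove≡ : ∀ a → fromAbove (toℕ a) ≡ (N ∸ toℕ a) * g a
    fromAbove≡ a = cong (λ m → (N ∸ toℕ a) * placements j i (toℕ a) m)
                        (trans (∸-+-assoc N (toℕ a) 1) (cong (N ∸_) (+-comm (toℕ a) 1)))
    fromAbove-N : fromAbove N ≡ 0
    fromAbove-N = cong (_* placements j i N (N ∸ N ∸ 1)) (n∸n≡0 N)

  rootedPlacements-closed : ∀ j i → rootedPlacements j i (suc j + i) * suc i ! ≡ (suc j + i) !
  rootedPlacements-closed zero    i = begin
    rootedPlacements 0 i (suc i) * suc i ! ≡⟨ cong (_* suc i !) (trans (hockey-stick (suc i) i) (nCn≡1 (suc i))) ⟩
    1 * suc i !                             ≡⟨ *-identityˡ (suc i !) ⟩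
    suc i !                                 ∎
    where open ≡-Reasoning
  rootedPlacements-closed (suc j) i = begin
    rootedPlacements (suc j) i (suc (suc j + i)) * suc i ! ≡⟨ cong (_* suc i !) (rootedPlacements-suc j i (suc j + i)) ⟩
    suc (suc j + i) * rootedPlacements j i (suc j + i) * suc i ! ≡⟨ *-assoc (suc (suc j + i)) (rootedPlacements j i (suc j + i)) (suc i !) ⟩
    suc (suc j + i) * (rootedPlacements j i (suc j + i) * suc i !) ≡⟨ cong (suc (suc j + i) *_) (rootedPlacements-closed j i) ⟩
    suc (suc j + i) * (suc j + i) ! ∎
    where open ≡-Reasoning

module Disposition where

  open import Data.Bool using (Bool; true; false; _∧_; not; T)
  open import Data.Bool.Properties using (T-∧)
  open import Data.Empty using (⊥-elim)
  open import Data.Fin as Fin using (Fin)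
  open import Data.List using ([]; _∷_; allFin)
  open import Data.List.Relation.Unary.All using (All; []; _∷_)
  open import Data.List.Relation.Unary.All.Properties using (tabulate⁺; tabulate⁻)
  open import Data.Product using (_×_; _,_; proj₁; proj₂)
  open import Data.Unit using (tt)
  open import Function using (_∘_; _⇔_; mk⇔; Injective; Equivalence)
  open Equivalence using (to; from)
  open import Relation.Nullary using (yes; no)
  open import Relation.Nullary.Decidable using (toWitness; fromWitness; toWitnessFalse; fromWitnessFalse)
  open import Relation.Binary.PropositionalEquality

  T-allᵇ : ∀ {A : Set} (p : A → Bool) xs → T (allᵇ p xs) ⇔ All (T ∘ p) xs
  T-allᵇ p []       = mk⇔ (λ _ → []) (λ _ → tt)
  T-allᵇ p (x ∷ xs) = mk⇔
    (λ h → let px , pxs = to T-∧ h in px ∷ to (T-allᵇ p xs) pxs)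
    (λ { (px ∷ pxs) → from T-∧ (px , from (T-allᵇ p xs) pxs) })

  T-⇒ᵇ : ∀ a b → T (a ⇒ᵇ b) ⇔ (T a → T b)
  T-⇒ᵇ false b     = mk⇔ (λ _ ()) (λ _ → tt)
  T-⇒ᵇ true  true  = mk⇔ (λ _ _ → tt) (λ _ → tt)
  T-⇒ᵇ true  false = mk⇔ (λ ()) (λ h → h tt)

  record IsDisposition (G : Digraph) (f : Fin (size G) → Fin (size G)) : Set where
    field
      injective  : Injective _≡_ _≡_ f
      decreasing : ∀ {u w} → T (arc G u w) → f w Fin.< f u

  isDisposition⇔IsDisposition : ∀ G f → T (isDisposition G f) ⇔ IsDisposition G f
  isDisposition⇔IsDisposition G f = mk⇔ sound complete
    where
    n = size G
    distinct decreases : Fin n → Fin n → Bool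
    distinct   u w = not (u ==ᶠ w) ⇒ᵇ not (f u ==ᶠ f w)
    decreases  u w = arc G u w ⇒ᵇ (f w <ᶠ f u)

    everyPair : T (isDisposition G f) ⇔ (∀ u w → T (distinct u w ∧ decreases u w))
    everyPair = mk⇔
      (λ h u → tabulate⁻ (to (T-allᵇ _ (allFin n)) (tabulate⁻ (to (T-allᵇ _ (allFin n)) h) u)))
      (λ h → from (T-allᵇ _ (allFin n)) (tabulate⁺ (λ u → from (T-allᵇ _ (allFin n)) (tabulate⁺ (h u)))))

    sound : T (isDisposition G f) → IsDisposition G f
    sound h = record { injective = injective ; decreasing = decreasing }
      where
      pair : ∀ u w → T (distinct u w) × T (decreases u w)
      pair u w = to T-∧ (to everyPair h u w)
      injective : Injective _≡_ _≡_ f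
      injective {u} {w} fu≡fw with u Fin.≟ w
      ... | yes u≡w = u≡w
      ... | no  u≢w = ⊥-elim (toWitnessFalse (to (T-⇒ᵇ (not (u ==ᶠ w)) _) (proj₁ (pair u w)) (fromWitnessFalse u≢w)) fu≡fw)
      decreasing : ∀ {u w} → T (arc G u w) → f w Fin.< f u
      decreasing {u} {w} uw = toWitness (to (T-⇒ᵇ (arc G u w) _) (proj₂ (pair u w)) uw)

    complete : IsDisposition G f → T (isDisposition G f)
    complete d = from everyPair (λ u w → from T-∧
      ( from (T-⇒ᵇ (not (u ==ᶠ w)) _) (λ u≢w → fromWitnessFalse (toWitnessFalse u≢w ∘ IsDisposition.injective d))
      , from (T-⇒ᵇ (arc G u w) _) (fromWitness ∘ IsDisposition.decreasing d)))

module ChainGraph where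

  open Disposition
  open DescendingAssignment
  open Placements
  open FunctionCount using (countFuns; countFuns-cong; countFuns-suc)
  open import Data.Nat as ℕ using (ℕ; suc; _+_; _*_; _!; _≤_)
  open import Data.Nat.Properties using (+-cancelˡ-≡; +-identityʳ; +-suc; m≤m+n; <-irrefl; <⇒≱; m≤n⇒m≤1+n; +-*-semiring)
  open import Data.Bool using (Bool; T)
  open import Data.Empty using (⊥-elim)
  open import Data.Fin as Fin using (Fin; toℕ; splitAt) renaming (zero to fzero; suc to fsuc)
  open import Data.Fin.Properties using (toℕ<n; 0≢1+n; suc-injective; toℕ-↑ˡ; toℕ-↑ʳ; splitAt⁻¹-↑ˡ; splitAt⁻¹-↑ʳ)
  open import Data.Sum using (inj₁; inj₂)
  open import Algebra.Properties.Semiring.Sum +-*-semiring using (sum-syntax; sum-cong-≗)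
  open import Function using (_∘_; _⇔_; mk⇔)
  open import Function.Construct.Composition using (_⇔-∘_)
  open import Function.Construct.Symmetry using (⇔-sym)
  open import Relation.Nullary.Decidable using (toWitness; fromWitness; toWitnessFalse; fromWitnessFalse)
  open import Relation.Binary.PropositionalEquality

  splitAt-inj₁⇒< : ∀ m {n} {k : Fin (m + n)} {p} → splitAt m k ≡ inj₁ p → toℕ k ℕ.< m
  splitAt-inj₁⇒< m {n} {p = p} eq = subst (ℕ._< m) (trans (sym (toℕ-↑ˡ p n)) (cong toℕ (splitAt⁻¹-↑ˡ eq))) (toℕ<n p)

  splitAt-inj₂⇒toℕ : ∀ m {n} {k : Fin (m + n)} {l} → splitAt m k ≡ inj₂ l → toℕ k ≡ m + toℕ l
  splitAt-inj₂⇒toℕ m {l = l} eq = trans (cong toℕ (sym (splitAt⁻¹-↑ʳ eq))) (toℕ-↑ʳ m l)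

  chainGraph : ℕ → ℕ → Digraph
  chainGraph j i = extend (E (suc j)) fzero i

  -- Vertex 0 is v₁, vertex k + 1 is v_{k+2} for k < j, and vertex j + l is z_l.
  data ChainArc (j : ℕ) {i : ℕ} : Fin (suc (j + i)) → Fin (suc (j + i)) → Set where
    root : ∀ {k} → toℕ k ≡ j → ChainArc j fzero (fsuc k)
    step : ∀ {k k'} → j ≤ toℕ k → toℕ k' ≡ suc (toℕ k) → ChainArc j (fsuc k) (fsuc k')

  arc⇒ChainArc : ∀ {j i} u w → T (arc (chainGraph j i) u w) → ChainArc j u w
  arc⇒ChainArc         fzero    fzero     ()
  arc⇒ChainArc {j}     fzero    (fsuc k)  h with splitAt j k in eq
  ... | inj₁ _ = ⊥-elim h
  ... | inj₂ l = root (trans (splitAt-inj₂⇒toℕ j eq) (trans (cong (j +_) (toWitness h)) (+-identityʳ j)))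
  arc⇒ChainArc {j}     (fsuc k) fzero     h with splitAt j k
  ... | inj₁ _ = ⊥-elim h
  ... | inj₂ _ = ⊥-elim h
  arc⇒ChainArc {j}     (fsuc k) (fsuc k') h with splitAt j k in eq | splitAt j k' in eq'
  ... | inj₁ _ | inj₁ _ = ⊥-elim h
  ... | inj₁ _ | inj₂ _ = ⊥-elim h
  ... | inj₂ _ | inj₁ _ = ⊥-elim h
  ... | inj₂ l | inj₂ l' = step
    (subst (j ≤_) (sym (splitAt-inj₂⇒toℕ j eq)) (m≤m+n j (toℕ l)))
    (trans (splitAt-inj₂⇒toℕ j eq')
      (trans (cong (j +_) (toWitness h)) (trans (+-suc j (toℕ l)) (cong suc (sym (splitAt-inj₂⇒toℕ j eq))))))

  ChainArc⇒arc : ∀ {j i u w} → ChainArc j {i} u w → T (arc (chainGraph j i) u w)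
  ChainArc⇒arc {j} (root {k} k≡j) with splitAt j k in eq
  ... | inj₁ _ = ⊥-elim (<-irrefl k≡j (splitAt-inj₁⇒< j eq))
  ... | inj₂ l = fromWitness (+-cancelˡ-≡ j (toℕ l) 0 (trans (sym (splitAt-inj₂⇒toℕ j eq)) (trans k≡j (sym (+-identityʳ j)))))
  ChainArc⇒arc {j} (step {k} {k'} j≤k k'≡1+k) with splitAt j k in eq | splitAt j k' in eq'
  ... | inj₁ _ | _      = ⊥-elim (<⇒≱ (splitAt-inj₁⇒< j eq) j≤k)
  ... | inj₂ _ | inj₁ _ = ⊥-elim (<⇒≱ (splitAt-inj₁⇒< j eq') (subst (j ≤_) (sym k'≡1+k) (m≤n⇒m≤1+n j≤k)))
  ... | inj₂ l | inj₂ l' = fromWitness (+-cancelˡ-≡ j (toℕ l') (suc (toℕ l))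
    (trans (sym (splitAt-inj₂⇒toℕ j eq')) (trans k'≡1+k (trans (cong suc (splitAt-inj₂⇒toℕ j eq)) (sym (+-suc j (toℕ l)))))))

  chainDispositionᵇ : ∀ j i {M} → (Fin (suc (j + i)) → Fin M) → Bool
  chainDispositionᵇ j i f = freeThenDescendingᵇ j i (_==ᶠ f fzero) (toℕ (f fzero)) (f ∘ fsuc)

  IsDisposition⇔FreeThenDescending : ∀ j i f →
    IsDisposition (chainGraph j i) f ⇔ FreeThenDescending j i (_==ᶠ f fzero) (toℕ (f fzero)) (f ∘ fsuc)
  IsDisposition⇔FreeThenDescending j i f = mk⇔
    (λ d → let open IsDisposition d in record
      { unused     = λ k → fromWitnessFalse (0≢1+n ∘ sym ∘ injective)
      ; injective  = suc-injective ∘ injective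
      ; belowBound = λ k≡j → decreasing (ChainArc⇒arc (root k≡j))
      ; descending = λ j≤k k'≡1+k → decreasing (ChainArc⇒arc (step j≤k k'≡1+k))
      })
    (λ s → let open FreeThenDescending s in record
      { injective  = λ { {fzero}  {fzero}   _  → refl
                       ; {fzero}  {fsuc k}  eq → ⊥-elim (toWitnessFalse (unused k) (sym eq))
                       ; {fsuc k} {fzero}   eq → ⊥-elim (toWitnessFalse (unused k) eq)
                       ; {fsuc k} {fsuc k'} eq → cong fsuc (injective eq) }
      ; decreasing = λ {u} {w} uw → decreasing-on (arc⇒ChainArc u w uw) s
      })
    where
    decreasing-on : ∀ {u w} → ChainArc j u w →
                    FreeThenDescending j i (_==ᶠ f fzero) (toℕ (f fzero)) (f ∘ fsuc) → f w Fin.< f u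
    decreasing-on (root k≡j)        s = FreeThenDescending.belowBound s k≡j
    decreasing-on (step j≤k k'≡1+k) s = FreeThenDescending.descending s j≤k k'≡1+k

  T-isDisposition⇔T-chainDispositionᵇ : ∀ j i f → T (isDisposition (chainGraph j i) f) ⇔ T (chainDispositionᵇ j i f)
  T-isDisposition⇔T-chainDispositionᵇ j i f =
    ⇔-sym (T-freeThenDescendingᵇ j i _ _ (f ∘ fsuc))
      ⇔-∘ (IsDisposition⇔FreeThenDescending j i f ⇔-∘ isDisposition⇔IsDisposition _ f)

  σ-chainGraph : ∀ j i → σ (chainGraph j i) * suc i ! ≡ (suc j + i) !
  σ-chainGraph j i = begin
    σ (chainGraph j i) * suc i !
      ≡⟨ cong (_* suc i !) (countFuns-cong (T-isDisposition⇔T-chainDispositionᵇ j i)) ⟩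
    countFuns (suc N) (suc N) (chainDispositionᵇ j i) * suc i !
      ≡⟨ cong (_* suc i !) (countFuns-suc N (suc N) (chainDispositionᵇ j i)) ⟩
    ∑[ a < suc N ] countFuns N (suc N) (freeThenDescendingᵇ j i (_==ᶠ a) (toℕ a)) * suc i !
      ≡⟨ cong (_* suc i !) (sum-cong-≗ (λ a → trans (count-freeThenDescending j i (suc N) (_==ᶠ a) (toℕ a))
                                                    (cong₂ (placements j i) (#below-singleton a) (#above-singleton a)))) ⟩
    rootedPlacements j i (suc N) * suc i !
      ≡⟨ rootedPlacements-closed j i ⟩
    (suc j + i) ! ∎
    where
    open ≡-Reasoning
    N = j + i

module Fraction where

  open import Data.Nat as ℕ using (ℕ; zero; suc; NonZero)
  import Data.Nat.Properties as ℕ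
  open import Data.Integer as ℤ using (+_)
  import Data.Integer.Properties as ℤ
  open import Data.Integer.Solver using () renaming (module +-*-Solver to ℤ-Solver)
  open import Data.Fin using (Fin) renaming (zero to fzero; suc to fsuc)
  open import Data.Rational using (_/_; _+_; _*_; fromℚᵘ; toℚᵘ)
  open import Data.Rational.Properties using (fromℚᵘ-cong; toℚᵘ-injective; toℚᵘ-fromℚᵘ; toℚᵘ-homo-+; toℚᵘ-homo-*; 0/n≡0; +-*-commutativeRing)
  open import Algebra.Bundles using (CommutativeRing)
  open import Algebra.Properties.Semiring.Sum (CommutativeRing.semiring +-*-commutativeRing) using (sum-syntax)
  import Algebra.Properties.Semiring.Sum ℕ.+-*-semiring as ℕΣ
  open import Function using (_∘_)
  import Data.Rational.Unnormalised as ℚᵘ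
  import Data.Rational.Unnormalised.Properties as ℚᵘ
  open import Relation.Binary.PropositionalEquality

  fromℚᵘ-homo-+ : ∀ p q → fromℚᵘ (p ℚᵘ.+ q) ≡ fromℚᵘ p + fromℚᵘ q
  fromℚᵘ-homo-+ p q = toℚᵘ-injective (begin
    toℚᵘ (fromℚᵘ (p ℚᵘ.+ q))                ≈⟨ toℚᵘ-fromℚᵘ (p ℚᵘ.+ q) ⟩
    p ℚᵘ.+ q                                ≈⟨ ℚᵘ.+-cong (toℚᵘ-fromℚᵘ p) (toℚᵘ-fromℚᵘ q) ⟨
    toℚᵘ (fromℚᵘ p) ℚᵘ.+ toℚᵘ (fromℚᵘ q)    ≈⟨ toℚᵘ-homo-+ (fromℚᵘ p) (fromℚᵘ q) ⟨
    toℚᵘ (fromℚᵘ p + fromℚᵘ q)              ∎)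
    where open ℚᵘ.≃-Reasoning

  fromℚᵘ-homo-* : ∀ p q → fromℚᵘ (p ℚᵘ.* q) ≡ fromℚᵘ p * fromℚᵘ q
  fromℚᵘ-homo-* p q = toℚᵘ-injective (begin
    toℚᵘ (fromℚᵘ (p ℚᵘ.* q))                ≈⟨ toℚᵘ-fromℚᵘ (p ℚᵘ.* q) ⟩
    p ℚᵘ.* q                                ≈⟨ ℚᵘ.*-cong (toℚᵘ-fromℚᵘ p) (toℚᵘ-fromℚᵘ q) ⟨
    toℚᵘ (fromℚᵘ p) ℚᵘ.* toℚᵘ (fromℚᵘ q)    ≈⟨ toℚᵘ-homo-* (fromℚᵘ p) (fromℚᵘ q) ⟨
    toℚᵘ (fromℚᵘ p * fromℚᵘ q)              ∎)
    where open ℚᵘ.≃-Reasoning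

  -- + a / suc d is definitionally fromℚᵘ (mkℚᵘ (+ a) d), which reduces these identities to ℚᵘ.
  *≡*⇒/≡/ : ∀ a b d e .{{_ : NonZero d}} .{{_ : NonZero e}} → a ℕ.* e ≡ b ℕ.* d → + a / d ≡ + b / e
  *≡*⇒/≡/ a b (suc d) (suc e) eq = fromℚᵘ-cong {ℚᵘ.mkℚᵘ (+ a) d} {ℚᵘ.mkℚᵘ (+ b) e}
    (ℚᵘ.*≡* (trans (sym (ℤ.pos-* a (suc e))) (trans (cong +_ eq) (ℤ.pos-* b (suc d)))))

  a/d+b/d≡[a+b]/d : ∀ a b d .{{_ : NonZero d}} → + a / d + + b / d ≡ + (a ℕ.+ b) / d
  a/d+b/d≡[a+b]/d a b (suc d) = trans (sym (fromℚᵘ-homo-+ p q))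
    (fromℚᵘ-cong {p ℚᵘ.+ q} {ℚᵘ.mkℚᵘ (+ (a ℕ.+ b)) d} (ℚᵘ.*≡* (trans
      (solve 3 (λ x y z → (x :* z :+ y :* z) :* z := (x :+ y) :* (z :* z)) refl (+ a) (+ b) (+ suc d))
      (cong₂ ℤ._*_ (sym (ℤ.pos-+ a b)) (sym (ℤ.pos-* (suc d) (suc d)))))))
    where
    open ℤ-Solver
    p = ℚᵘ.mkℚᵘ (+ a) d
    q = ℚᵘ.mkℚᵘ (+ b) d

  a/d*b/e≡ab/de : ∀ a b d e .{{_ : NonZero d}} .{{_ : NonZero e}} →
                  (+ a / d) * (+ b / e) ≡ (+ (a ℕ.* b) / (d ℕ.* e)) {{ℕ.m*n≢0 d e}}
  a/d*b/e≡ab/de a b (suc d) (suc e) = trans (sym (fromℚᵘ-homo-* p q))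
    (fromℚᵘ-cong {p ℚᵘ.* q} {ℚᵘ.mkℚᵘ (+ (a ℕ.* b)) (e ℕ.+ d ℕ.* suc e)}
      (ℚᵘ.*≡* (cong (ℤ._* + (suc d ℕ.* suc e)) (sym (ℤ.pos-* a b)))))
    where
    p = ℚᵘ.mkℚᵘ (+ a) d
    q = ℚᵘ.mkℚᵘ (+ b) e

  ∑a/d≡[∑a]/d : ∀ n (a : Fin n → ℕ) d .{{_ : NonZero d}} → ∑[ k < n ] (+ a k / d) ≡ + ℕΣ.sum a / d
  ∑a/d≡[∑a]/d zero    a d = sym (0/n≡0 d)
  ∑a/d≡[∑a]/d (suc n) a d =
    trans (cong (λ s → + a fzero / d + s) (∑a/d≡[∑a]/d n (a ∘ fsuc) d)) (a/d+b/d≡[a+b]/d (a fzero) _ d)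

  a/1*b/d≡ab/d : ∀ a b d .{{_ : NonZero d}} → (+ a / 1) * (+ b / d) ≡ + (a ℕ.* b) / d
  a/1*b/d≡ab/d a b d = trans (a/d*b/e≡ab/de a b 1 d)
    (*≡*⇒/≡/ (a ℕ.* b) (a ℕ.* b) (1 ℕ.* d) d {{ℕ.m*n≢0 1 d}} (cong ((a ℕ.* b) ℕ.*_) (sym (ℕ.*-identityˡ d))))

module PowerSeries where

  open FiniteSums
  open Fraction using (a/d*b/e≡ab/de; a/d+b/d≡[a+b]/d)
  open import Data.Nat as ℕ using (ℕ; zero; suc; _∸_; _<_)
  import Data.Nat.Properties as ℕ
  open import Data.Nat.Induction using (<-rec)
  open import Data.Fin using (toℕ)
  open import Data.Fin.Properties using (toℕ<n)
  open import Data.List using (foldr; applyUpTo)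
  open import Data.Integer using (+_)
  open import Data.Rational using (_/_; _+_; _*_; _-_; 1ℚ)
  open import Data.Rational.Properties using (+-*-commutativeRing; +-0-group; +-0-monoid; *-identityʳ)
  open import Data.Rational.Solver using () renaming (module +-*-Solver to ℚ-Solver)
  open import Algebra.Bundles using (CommutativeRing)
  open import Algebra.Properties.Semiring.Sum (CommutativeRing.semiring +-*-commutativeRing)
    using (sum-syntax; sum-cong-≗)
  open import Algebra.Properties.Group +-0-group using (∙-cancelˡ)
  open import Function using (_∘_; id)
  open import Relation.Binary.PropositionalEquality

  Σ≤≡∑ : ∀ n f → Σ≤ n f ≡ ∑[ k < suc n ] f (toℕ k)
  Σ≤≡∑ n f = go (suc n) id
    where
    go : ∀ m (g : ℕ → ℕ) → foldr (λ k acc → f k + acc) 0ℚ (applyUpTo g m) ≡ ∑[ k < m ] f (g (toℕ k))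
    go zero    g = refl
    go (suc m) g = cong (λ s → f (g 0) + s) (go m (g ∘ suc))

  ⊛-last : ∀ (A B : FPS) n → (A ⊛ B) n ≡ ∑[ k < n ] (A (toℕ k) * B (n ∸ toℕ k)) + A n * B 0
  ⊛-last A B n = begin
    (A ⊛ B) n                                                  ≡⟨ Σ≤≡∑ n (λ k → A k * B (n ∸ k)) ⟩
    ∑[ k < suc n ] (A (toℕ k) * B (n ∸ toℕ k))                 ≡⟨ ∑-toℕ-last +-0-monoid n (λ k → A k * B (n ∸ k)) ⟩
    ∑[ k < n ] (A (toℕ k) * B (n ∸ toℕ k)) + A n * B (n ∸ n)   ≡⟨ cong (λ m → ∑[ k < n ] (A (toℕ k) * B (n ∸ toℕ k)) + A n * B m) (ℕ.n∸n≡0 n) ⟩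
    ∑[ k < n ] (A (toℕ k) * B (n ∸ toℕ k)) + A n * B 0         ∎
    where open ≡-Reasoning

  ⊛-cancelʳ : ∀ {A B} (F : FPS) → F 0 ≡ 1ℚ → (∀ n → (A ⊛ F) n ≡ (B ⊛ F) n) → ∀ n → A n ≡ B n
  ⊛-cancelʳ {A} {B} F F₀≡1 A⊛F≡B⊛F = <-rec _ step
    where
    step : ∀ n → (∀ {k} → k < n → A k ≡ B k) → A n ≡ B n
    step n A≡B-below = begin
      A n        ≡⟨ *-identityʳ (A n) ⟨
      A n * 1ℚ   ≡⟨ cong (A n *_) F₀≡1 ⟨
      A n * F 0  ≡⟨ ∙-cancelˡ earlier (A n * F 0) (B n * F 0) (begin
         earlier + A n * F 0 ≡⟨ ⊛-last A F n ⟨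
         (A ⊛ F) n           ≡⟨ A⊛F≡B⊛F n ⟩
         (B ⊛ F) n           ≡⟨ ⊛-last B F n ⟩
         ∑[ k < n ] (B (toℕ k) * F (n ∸ toℕ k)) + B n * F 0
           ≡⟨ cong (_+ B n * F 0) (sum-cong-≗ {n} (λ k → cong (_* F (n ∸ toℕ k)) (A≡B-below (toℕ<n k)))) ⟨
         earlier + B n * F 0 ∎) ⟩
      B n * F 0  ≡⟨ cong (B n *_) F₀≡1 ⟩
      B n * 1ℚ   ≡⟨ *-identityʳ (B n) ⟩
      B n        ∎
      where
      open ≡-Reasoning
      earlier = ∑[ k < n ] (A (toℕ k) * F (n ∸ toℕ k))

  odeCoefficient : ∀ (T : FPS) j n → ((X* (D (D T)) ⊕ ((2 · D T) ⊕ X* (D T))) ⊖ (j · T)) n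
                                     ≡ (+ (suc n ℕ.* suc (suc n)) / 1 * T (suc n) + + n / 1 * T n) - + j / 1 * T n
  odeCoefficient T j zero    = solve 3 (λ x t₀ t₁ → (con 0ℚ :+ (con (+ 2 / 1) :* (con 1ℚ :* t₁) :+ con 0ℚ)) :- x :* t₀
                                               := (con (+ 2 / 1) :* t₁ :+ con 0ℚ :* t₀) :- x :* t₀) refl (+ j / 1) (T 0) (T 1)
    where open ℚ-Solver
  odeCoefficient T j (suc m) = begin
    (a * (b * T (suc (suc m))) + (+ 2 / 1 * (b * T (suc (suc m))) + a * T (suc m))) - jℚ * T (suc m)
      ≡⟨ solve 6 (λ a b c x t₁ t₂ → (a :* (b :* t₂) :+ (c :* (b :* t₂) :+ a :* t₁)) :- x :* t₁
                                  := ((a :* b :+ c :* b) :* t₂ :+ a :* t₁) :- x :* t₁)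
               refl a b (+ 2 / 1) jℚ (T (suc m)) (T (suc (suc m))) ⟩
    ((a * b + + 2 / 1 * b) * T (suc (suc m)) + a * T (suc m)) - jℚ * T (suc m)
      ≡⟨ cong (λ x → (x * T (suc (suc m)) + a * T (suc m)) - jℚ * T (suc m)) coefficient ⟩
    (+ (suc (suc m) ℕ.* suc (suc (suc m))) / 1 * T (suc (suc m)) + a * T (suc m)) - jℚ * T (suc m) ∎
    where
    open ≡-Reasoning
    open ℚ-Solver
    a = + suc m / 1
    b = + suc (suc m) / 1
    jℚ = + j / 1
    coefficient : a * b + + 2 / 1 * b ≡ + (suc (suc m) ℕ.* suc (suc (suc m))) / 1
    coefficient = trans (cong₂ _+_ (a/d*b/e≡ab/de (suc m) (suc (suc m)) 1 1) (a/d*b/e≡ab/de 2 (suc (suc m)) 1 1))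
      (trans (a/d+b/d≡[a+b]/d (suc m ℕ.* suc (suc m)) (2 ℕ.* suc (suc m)) 1)
        (cong (λ x → + x / 1) (trans (sym (ℕ.*-distribʳ-+ (suc (suc m)) (suc m) 2))
          (trans (cong (ℕ._* suc (suc m)) (ℕ.+-comm (suc m) 2)) (ℕ.*-comm (suc (suc (suc m))) (suc (suc m)))))))

module Companion where

  open PowerSeries using (Σ≤≡∑)
  open Binomial using (nCk*k!*[n∸k]!≡n!; [m+n]Cn*[m!*n!]≡[m+n]!; ∑jCk*[1+n]C[1+k]≡[1+j+n]Cn; [1+k]*nC[1+k]+k*nCk≡n*nCk)
  open Fraction
  open ChainGraph using (chainGraph; σ-chainGraph)
  open import Data.Nat as ℕ using (ℕ; suc; _∸_; _!; _≤_)
  import Data.Nat.Properties as ℕ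
  open import Data.Nat.Combinatorics using (_C_)
  open import Data.Nat.Solver using () renaming (module +-*-Solver to ℕ-Solver)
  open import Data.Fin using (Fin; toℕ) renaming (zero to fzero)
  open import Data.Fin.Properties using (toℕ≤pred[n])
  open import Data.Integer using (+_)
  open import Data.Rational using (_/_; _+_; _*_)
  open import Data.Rational.Properties using (+-*-commutativeRing)
  open import Algebra.Bundles using (CommutativeRing)
  open import Algebra.Properties.Semiring.Sum (CommutativeRing.semiring +-*-commutativeRing)
    using (sum-syntax; sum-cong-≗)
  import Algebra.Properties.Semiring.Sum ℕ.+-*-semiring as ℕΣ
  open import Relation.Binary.PropositionalEquality

  companion : ℕ → FPS
  companion j k = (+ (suc j ! ℕ.* (j C k)) / suc k !) {{suc k ℕ.!≢0}}

  companion-term : ∀ j n k → k ≤ n →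
    companion j k * expS (n ∸ k) ≡ (+ (suc j ! ℕ.* ((j C k) ℕ.* (suc n C suc k))) / suc n !) {{suc n ℕ.!≢0}}
  companion-term j n k k≤n = trans
    (a/d*b/e≡ab/de (c ℕ.* b) 1 (suc k !) ((n ∸ k) !))
    (*≡*⇒/≡/ (c ℕ.* b ℕ.* 1) (c ℕ.* (b ℕ.* B)) (suc k ! ℕ.* (n ∸ k) !) (suc n !) {{suc k ℕ.!* (n ∸ k) !≢0}} (begin
      c ℕ.* b ℕ.* 1 ℕ.* suc n !                     ≡⟨ cong (ℕ._* suc n !) (ℕ.*-identityʳ (c ℕ.* b)) ⟩
      c ℕ.* b ℕ.* suc n !                           ≡⟨ cong (c ℕ.* b ℕ.*_) (nCk*k!*[n∸k]!≡n! (ℕ.s≤s k≤n)) ⟨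
      c ℕ.* b ℕ.* (B ℕ.* (suc k ! ℕ.* (n ∸ k) !))   ≡⟨ solve 4 (λ c b B d → c :* b :* (B :* d) := c :* (b :* B) :* d)
                                                               refl c b B (suc k ! ℕ.* (n ∸ k) !) ⟩
      c ℕ.* (b ℕ.* B) ℕ.* (suc k ! ℕ.* (n ∸ k) !)   ∎))
    where
    open ≡-Reasoning
    open ℕ-Solver
    instance
      _ = suc k ℕ.!≢0
      _ = (n ∸ k) ℕ.!≢0
      _ = suc n ℕ.!≢0
    c = suc j !
    b = j C k
    B = suc n C suc k

  companion-numerators : ∀ j n →
    ℕΣ.sum (λ (k : Fin (suc n)) → suc j ! ℕ.* ((j C toℕ k) ℕ.* (suc n C suc (toℕ k)))) ℕ.* n ! ≡ (suc j ℕ.+ n) !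
  companion-numerators j n = begin
    ℕΣ.sum (λ k → suc j ! ℕ.* binomials k) ℕ.* n !
      ≡⟨ cong (ℕ._* n !) (ℕΣ.*-distribˡ-sum (suc j !) binomials) ⟨
    suc j ! ℕ.* ℕΣ.sum binomials ℕ.* n !
      ≡⟨ cong (λ s → suc j ! ℕ.* s ℕ.* n !) (∑jCk*[1+n]C[1+k]≡[1+j+n]Cn j n) ⟩
    suc j ! ℕ.* ((suc j ℕ.+ n) C n) ℕ.* n !
      ≡⟨ solve 3 (λ a b c → a :* b :* c := b :* (a :* c)) refl (suc j !) ((suc j ℕ.+ n) C n) (n !) ⟩
    ((suc j ℕ.+ n) C n) ℕ.* (suc j ! ℕ.* n !)
      ≡⟨ [m+n]Cn*[m!*n!]≡[m+n]! (suc j) n ⟩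
    (suc j ℕ.+ n) ! ∎
    where
    open ≡-Reasoning
    open ℕ-Solver
    binomials : Fin (suc n) → ℕ
    binomials k = (j C toℕ k) ℕ.* (suc n C suc (toℕ k))

  companion-⊛-exp : ∀ j n → (companion j ⊛ expS) n ≡ egfσ (E (suc j)) fzero n
  companion-⊛-exp j n = begin
    (companion j ⊛ expS) n                                   ≡⟨ Σ≤≡∑ n (λ k → companion j k * expS (n ∸ k)) ⟩
    ∑[ k < suc n ] (companion j (toℕ k) * expS (n ∸ toℕ k))  ≡⟨ sum-cong-≗ {suc n} (λ k → companion-term j n (toℕ k) (toℕ≤pred[n] k)) ⟩
    ∑[ k < suc n ] (+ numerator k / suc n !)                 ≡⟨ ∑a/d≡[∑a]/d (suc n) numerator (suc n !) ⟩
    + ℕΣ.sum numerator / suc n !                             ≡⟨ *≡*⇒/≡/ (ℕΣ.sum numerator) (σ (chainGraph j n)) (suc n !) (n !)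
                                                                  (trans (companion-numerators j n) (sym (σ-chainGraph j n))) ⟩
    egfσ (E (suc j)) fzero n                                 ∎
    where
    open ≡-Reasoning
    instance
      _ = suc n ℕ.!≢0
      _ = n ℕ.!≢0
    numerator : Fin (suc n) → ℕ
    numerator k = suc j ! ℕ.* ((j C toℕ k) ℕ.* (suc n C suc (toℕ k)))

  companion-recurrence : ∀ j n →
    + (suc n ℕ.* suc (suc n)) / 1 * companion j (suc n) + + n / 1 * companion j n ≡ + j / 1 * companion j n
  companion-recurrence j n = begin
    + (suc n ℕ.* suc (suc n)) / 1 * companion j (suc n) + + n / 1 * companion j n
      ≡⟨ cong₂ _+_ (trans (a/1*b/d≡ab/d (suc n ℕ.* suc (suc n)) (c ℕ.* b₁) (suc (suc n) !)) cancel-2+n)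
                   (a/1*b/d≡ab/d n (c ℕ.* b₀) F) ⟩
    + (suc n ℕ.* (c ℕ.* b₁)) / F + + (n ℕ.* (c ℕ.* b₀)) / F
      ≡⟨ a/d+b/d≡[a+b]/d (suc n ℕ.* (c ℕ.* b₁)) (n ℕ.* (c ℕ.* b₀)) F ⟩
    + (suc n ℕ.* (c ℕ.* b₁) ℕ.+ n ℕ.* (c ℕ.* b₀)) / F
      ≡⟨ cong (λ x → + x / F) numerators ⟩
    + (j ℕ.* (c ℕ.* b₀)) / F
      ≡⟨ a/1*b/d≡ab/d j (c ℕ.* b₀) F ⟨
    + j / 1 * companion j n ∎
    where
    open ≡-Reasoning
    open ℕ-Solver
    instance
      _ = suc n ℕ.!≢0
      _ = suc (suc n) ℕ.!≢0
    c = suc j !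
    F = suc n !
    b₀ = j C n
    b₁ = j C suc n
    cancel-2+n : + (suc n ℕ.* suc (suc n) ℕ.* (c ℕ.* b₁)) / suc (suc n) ! ≡ + (suc n ℕ.* (c ℕ.* b₁)) / F
    cancel-2+n = *≡*⇒/≡/ (suc n ℕ.* suc (suc n) ℕ.* (c ℕ.* b₁)) (suc n ℕ.* (c ℕ.* b₁)) (suc (suc n) !) F
      (solve 4 (λ a b x f → a :* b :* x :* f := a :* x :* (b :* f)) refl (suc n) (suc (suc n)) (c ℕ.* b₁) F)
    numerators : suc n ℕ.* (c ℕ.* b₁) ℕ.+ n ℕ.* (c ℕ.* b₀) ≡ j ℕ.* (c ℕ.* b₀)
    numerators = begin
      suc n ℕ.* (c ℕ.* b₁) ℕ.+ n ℕ.* (c ℕ.* b₀)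
        ≡⟨ solve 4 (λ n c b₀ b₁ → (con 1 :+ n) :* (c :* b₁) :+ n :* (c :* b₀) := c :* ((con 1 :+ n) :* b₁ :+ n :* b₀))
                 refl n c b₀ b₁ ⟩
      c ℕ.* (suc n ℕ.* b₁ ℕ.+ n ℕ.* b₀)
        ≡⟨ cong (c ℕ.*_) ([1+k]*nC[1+k]+k*nCk≡n*nCk j n) ⟩
      c ℕ.* (j ℕ.* b₀)
        ≡⟨ solve 3 (λ c j b → c :* (j :* b) := j :* (c :* b)) refl c j b₀ ⟩
      j ℕ.* (c ℕ.* b₀) ∎

open PowerSeries using (⊛-cancelʳ; odeCoefficient)
open Companion using (companion; companion-⊛-exp; companion-recurrence)
open import Data.Nat using (_*_)
open import Data.Integer using (+_)
open import Data.Rational using (_/_; _+_; _-_) renaming (_*_ to _*ℚ_)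
open import Data.Rational.Properties using (+-inverseʳ)
open import Relation.Binary.PropositionalEquality using (refl; sym; trans; cong; cong₂; module ≡-Reasoning)

mainTheorem11 : (j : ℕ) (T : FPS) → IsCompanion (E (suc j)) zero T →
    ∀ n → ((X* (D (D T)) ⊕ ((2 · D T) ⊕ X* (D T))) ⊖ (j · T)) n ≡ 0ℚ
mainTheorem11 j T isCompanion n = begin
  ((X* (D (D T)) ⊕ ((2 · D T) ⊕ X* (D T))) ⊖ (j · T)) n
    ≡⟨ odeCoefficient T j n ⟩
  (+ (suc n * suc (suc n)) / 1 *ℚ T (suc n) + + n / 1 *ℚ T n) - + j / 1 *ℚ T n
    ≡⟨ cong₂ (λ x y → (+ (suc n * suc (suc n)) / 1 *ℚ x + + n / 1 *ℚ y) - + j / 1 *ℚ y)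
             (T≗companion (suc n)) (T≗companion n) ⟩
  (+ (suc n * suc (suc n)) / 1 *ℚ companion j (suc n) + + n / 1 *ℚ companion j n) - + j / 1 *ℚ companion j n
    ≡⟨ cong (_- + j / 1 *ℚ companion j n) (companion-recurrence j n) ⟩
  + j / 1 *ℚ companion j n - + j / 1 *ℚ companion j n
    ≡⟨ +-inverseʳ (+ j / 1 *ℚ companion j n) ⟩
  0ℚ ∎
  where
  open ≡-Reasoning
  T≗companion : ∀ m → T m ≡ companion j m
  T≗companion = ⊛-cancelʳ expS refl (λ m → trans (isCompanion m) (sym (companion-⊛-exp j m)))
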